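{- Let $\ell$ be a positive integer, let $G=(V,E)$ be a graph with $|V|=m$, let $0<\alpha<1/\ell^2$, suppose the minimum degree of $G$ is at least $m\left(\frac{\ell^2-1}{\ell^2}+\alpha\right)$, and suppose $m$ is large enough. Consider any collection of $\lfloor m/\ell\rfloor$ vertex-disjoint copies of $K_\ell$ in $G$. Then for each copy in this collection, with vertex set $C$, there are at least $$m\ell\alpha-\ell(\ell-1)$$ other copies in the collection, with vertex sets $D_1,D_2,\ldots$, such that $C\cup D_i$ spans a complete graph on $2\ell$ vertices in $G$.
   Formalization: The parameter α ranges over the rationals. -}

module Defs where

open import Data.Nat as ℕ using (ℕ; NonZero; _*_; _∸_)
open import Data.Nat.Properties using (m*n≢0)
open import Data.Integer using (+_)
open import Data.Rational using (ℚ; _/_)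
open import Data.Fin using (Fin)
open import Data.Fin.Subset using (Subset; _∈_; ∣_∣)
open import Data.Vec using (tabulate)
open import Data.Bool using (Bool; true; false)
open import Data.Product using (_×_)
open import Relation.Binary.PropositionalEquality using (_≡_; _≢_)

ℕ→ℚ : ℕ → ℚ
ℕ→ℚ n = + n / 1

lead : (ℓ : ℕ) → .{{NonZero ℓ}} → ℚ
lead ℓ = + (ℓ * ℓ ∸ 1) / (ℓ * ℓ)
  where instance _ = m*n≢0 ℓ ℓ

inv-sq : (ℓ : ℕ) → .{{NonZero ℓ}} → ℚ
inv-sq ℓ = + 1 / (ℓ * ℓ)
  where instance _ = m*n≢0 ℓ ℓ

record Graph (m : ℕ) : Set where
  field
    adj     : Fin m → Fin m → Bool
    sym     : ∀ u v → adj u v ≡ adj v u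
    irrefl  : ∀ v → adj v v ≡ false

open Graph public

N : ∀ {m} → Graph m → Fin m → Subset m
N G v = tabulate (adj G v)

deg : ∀ {m} → Graph m → Fin m → ℕ
deg G v = ∣ N G v ∣

IsClique : ∀ {m} → Graph m → Subset m → Set
IsClique G S = ∀ u v → u ∈ S → v ∈ S → u ≢ v → adj G u v ≡ true

IsCopyOfK : ∀ {m} → Graph m → ℕ → Subset m → Set
IsCopyOfK G k S = ∣ S ∣ ≡ k × IsClique G S

{-# OPTIONS --safe #-}
module Submission where

-- Fix a copy C = C i and let U be the set of vertices outside C that miss some vertex of C.
-- A copy D ≠ C disjoint from U is completely joined to C, so C ∪ D is a clique; since the
-- copies are pairwise disjoint, at most |U| copies meet U.  Each u ∈ C has at most
-- m − 1 − deg u non-neighbours outside C, so |U| ≤ ℓm − ℓ − Σ_{u ∈ C} deg u, while the degree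
-- condition gives Σ_{u ∈ C} deg u ≥ ℓm(1 − 1/ℓ² + α).  As there are ⌊m/ℓ⌋ > m/ℓ − 1 copies,
-- at least ℓmα + (ℓ − 1)²/ℓ of them are partners of C.  This holds for every m.

module SubsetCounting where

  open import Data.Nat as ℕ using (ℕ; suc; _+_; _*_; _≤_; z≤n; s≤s)
  open import Data.Nat.Properties as ℕ using (≤-trans; +-mono-≤; +-monoʳ-≤; +-suc; m≤m+n)
  open import Data.Nat.Tactic.RingSolver using (solve-∀)
  open import Data.Fin using (Fin; zero; suc)
  open import Data.Fin.Properties using (suc-injective)
  open import Data.Fin.Subset
  open import Data.Fin.Subset.Properties
  open import Data.Vec using ([]; _∷_; here; there; tabulate)
  open import Data.Vec.Properties using (lookup∘tabulate; []=⇒lookup; lookup⇒[]=)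
  open import Data.Bool using (Bool; true)
  open import Data.Product using (_×_; _,_; ∃-syntax)
  open import Data.Sum using (inj₁; inj₂)
  open import Function using (_∘_)
  open import Relation.Nullary using (yes; no; does; contradiction)
  open import Relation.Nullary.Decidable using (dec-true)
  open import Relation.Unary using (Pred; Decidable)
  open import Relation.Binary.PropositionalEquality

  private variable
    k n : ℕ

  ∈tabulate⁻ : ∀ {f : Fin n → Bool} {x} → x ∈ tabulate f → f x ≡ true
  ∈tabulate⁻ {f = f} {x} x∈ = trans (sym (lookup∘tabulate f x)) ([]=⇒lookup x∈)

  ∈tabulate⁺ : ∀ {f : Fin n → Bool} {x} → f x ≡ true → x ∈ tabulate f
  ∈tabulate⁺ {f = f} {x} fx = lookup⇒[]= x (tabulate f) (trans (lookup∘tabulate f x) fx)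

  satisfying : ∀ {p} {P : Pred (Fin n) p} → Decidable P → Subset n
  satisfying P? = tabulate (does ∘ P?)

  module _ {p} {P : Pred (Fin n) p} (P? : Decidable P) where

    ∈satisfying⁻ : ∀ {x} → x ∈ satisfying P? → P x
    ∈satisfying⁻ {x} x∈ with P? x | ∈tabulate⁻ {f = does ∘ P?} x∈
    ... | yes px | _  = px
    ... | no  _  | ()

    ∈satisfying⁺ : ∀ {x} → P x → x ∈ satisfying P?
    ∈satisfying⁺ {x} px = ∈tabulate⁺ {f = does ∘ P?} (dec-true (P? x) px)

  ∣p∪q∣+∣p∩q∣≡∣p∣+∣q∣ : (p q : Subset n) → ∣ p ∪ q ∣ + ∣ p ∩ q ∣ ≡ ∣ p ∣ + ∣ q ∣
  ∣p∪q∣+∣p∩q∣≡∣p∣+∣q∣ []            []            = refl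
  ∣p∪q∣+∣p∩q∣≡∣p∣+∣q∣ (inside  ∷ p) (inside  ∷ q) =
    cong suc (trans (+-suc ∣ p ∪ q ∣ ∣ p ∩ q ∣)
               (trans (cong suc (∣p∪q∣+∣p∩q∣≡∣p∣+∣q∣ p q)) (sym (+-suc ∣ p ∣ ∣ q ∣))))
  ∣p∪q∣+∣p∩q∣≡∣p∣+∣q∣ (inside  ∷ p) (outside ∷ q) = cong suc (∣p∪q∣+∣p∩q∣≡∣p∣+∣q∣ p q)
  ∣p∪q∣+∣p∩q∣≡∣p∣+∣q∣ (outside ∷ p) (inside  ∷ q) =
    trans (cong suc (∣p∪q∣+∣p∩q∣≡∣p∣+∣q∣ p q)) (sym (+-suc ∣ p ∣ ∣ q ∣))
  ∣p∪q∣+∣p∩q∣≡∣p∣+∣q∣ (outside ∷ p) (outside ∷ q) = ∣p∪q∣+∣p∩q∣≡∣p∣+∣q∣ p q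

  ∣p∪q∣≤∣p∣+∣q∣ : (p q : Subset n) → ∣ p ∪ q ∣ ≤ ∣ p ∣ + ∣ q ∣
  ∣p∪q∣≤∣p∣+∣q∣ p q = ≤-trans (m≤m+n ∣ p ∪ q ∣ ∣ p ∩ q ∣) (ℕ.≤-reflexive (∣p∪q∣+∣p∩q∣≡∣p∣+∣q∣ p q))

  Empty[p∩q]⇒∣p∪q∣≡∣p∣+∣q∣ : (p q : Subset n) → Empty (p ∩ q) → ∣ p ∪ q ∣ ≡ ∣ p ∣ + ∣ q ∣
  Empty[p∩q]⇒∣p∪q∣≡∣p∣+∣q∣ {n} p q p∩q-empty = begin
    ∣ p ∪ q ∣                  ≡⟨ ℕ.+-identityʳ _ ⟨
    ∣ p ∪ q ∣ + 0              ≡⟨ cong (∣ p ∪ q ∣ +_) (∣⊥∣≡0 n) ⟨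
    ∣ p ∪ q ∣ + ∣ ⊥ {n = n} ∣  ≡⟨ cong (λ r → ∣ p ∪ q ∣ + ∣ r ∣) (Empty-unique p∩q-empty) ⟨
    ∣ p ∪ q ∣ + ∣ p ∩ q ∣      ≡⟨ ∣p∪q∣+∣p∩q∣≡∣p∣+∣q∣ p q ⟩
    ∣ p ∣ + ∣ q ∣              ∎
    where open ≡-Reasoning

  ∑⟨_⟩ : Subset k → (Fin k → ℕ) → ℕ
  ∑⟨ []          ⟩ f = 0
  ∑⟨ inside  ∷ S ⟩ f = f zero + ∑⟨ S ⟩ (f ∘ suc)
  ∑⟨ outside ∷ S ⟩ f = ∑⟨ S ⟩ (f ∘ suc)

  ⋃⟨_⟩ : Subset k → (Fin k → Subset n) → Subset n
  ⋃⟨ []          ⟩ F = ⊥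
  ⋃⟨ inside  ∷ S ⟩ F = F zero ∪ ⋃⟨ S ⟩ (F ∘ suc)
  ⋃⟨ outside ∷ S ⟩ F = ⋃⟨ S ⟩ (F ∘ suc)

  PairwiseDisjoint : (Fin k → Subset n) → Set
  PairwiseDisjoint F = ∀ i j → i ≢ j → Empty (F i ∩ F j)

  PairwiseDisjoint-∘suc : (F : Fin (suc k) → Subset n) → PairwiseDisjoint F → PairwiseDisjoint (F ∘ suc)
  PairwiseDisjoint-∘suc F disjoint i j i≢j = disjoint (suc i) (suc j) (i≢j ∘ suc-injective)

  ∑⟨⟩-mono-≤ : (S : Subset k) {f g : Fin k → ℕ} → (∀ {x} → x ∈ S → f x ≤ g x) → ∑⟨ S ⟩ f ≤ ∑⟨ S ⟩ g
  ∑⟨⟩-mono-≤ []            f≤g = z≤n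
  ∑⟨⟩-mono-≤ (inside  ∷ S) f≤g = +-mono-≤ (f≤g here) (∑⟨⟩-mono-≤ S (f≤g ∘ there))
  ∑⟨⟩-mono-≤ (outside ∷ S) f≤g = ∑⟨⟩-mono-≤ S (f≤g ∘ there)

  ∑⟨⟩-distrib-+ : (S : Subset k) (f g : Fin k → ℕ) →
                  ∑⟨ S ⟩ (λ x → f x + g x) ≡ ∑⟨ S ⟩ f + ∑⟨ S ⟩ g
  ∑⟨⟩-distrib-+ []            f g = refl
  ∑⟨⟩-distrib-+ (inside  ∷ S) f g = begin
    f zero + g zero + ∑⟨ S ⟩ (λ x → f (suc x) + g (suc x))
      ≡⟨ cong (f zero + g zero +_) (∑⟨⟩-distrib-+ S (f ∘ suc) (g ∘ suc)) ⟩
    f zero + g zero + (∑⟨ S ⟩ (f ∘ suc) + ∑⟨ S ⟩ (g ∘ suc))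
      ≡⟨ +-interchange (f zero) (g zero) _ _ ⟩
    f zero + ∑⟨ S ⟩ (f ∘ suc) + (g zero + ∑⟨ S ⟩ (g ∘ suc)) ∎
    where
    open ≡-Reasoning
    +-interchange : ∀ a b c d → a + b + (c + d) ≡ a + c + (b + d)
    +-interchange = solve-∀
  ∑⟨⟩-distrib-+ (outside ∷ S) f g = ∑⟨⟩-distrib-+ S (f ∘ suc) (g ∘ suc)

  ∑⟨⟩-const : (S : Subset k) (c : ℕ) → ∑⟨ S ⟩ (λ _ → c) ≡ ∣ S ∣ * c
  ∑⟨⟩-const []            c = refl
  ∑⟨⟩-const (inside  ∷ S) c = cong (c +_) (∑⟨⟩-const S c)
  ∑⟨⟩-const (outside ∷ S) c = ∑⟨⟩-const S c

  ∈⋃⟨⟩⁺ : (S : Subset k) (F : Fin k → Subset n) {j : Fin k} {x : Fin n} →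
          j ∈ S → x ∈ F j → x ∈ ⋃⟨ S ⟩ F
  ∈⋃⟨⟩⁺ (inside  ∷ S) F here        x∈Fj = x∈p∪q⁺ (inj₁ x∈Fj)
  ∈⋃⟨⟩⁺ (inside  ∷ S) F (there j∈S) x∈Fj = x∈p∪q⁺ (inj₂ (∈⋃⟨⟩⁺ S (F ∘ suc) j∈S x∈Fj))
  ∈⋃⟨⟩⁺ (outside ∷ S) F (there j∈S) x∈Fj = ∈⋃⟨⟩⁺ S (F ∘ suc) j∈S x∈Fj

  ∈⋃⟨⟩⁻ : (S : Subset k) (F : Fin k → Subset n) {x : Fin n} →
          x ∈ ⋃⟨ S ⟩ F → ∃[ j ] (j ∈ S × x ∈ F j)
  ∈⋃⟨⟩⁻ []            F x∈⋃ = contradiction x∈⋃ ∉⊥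
  ∈⋃⟨⟩⁻ (inside  ∷ S) F x∈⋃ with x∈p∪q⁻ (F zero) (⋃⟨ S ⟩ (F ∘ suc)) x∈⋃
  ... | inj₁ x∈F0 = zero , here , x∈F0
  ... | inj₂ x∈⋃′ with ∈⋃⟨⟩⁻ S (F ∘ suc) x∈⋃′
  ...   | j , j∈S , x∈Fj = suc j , there j∈S , x∈Fj
  ∈⋃⟨⟩⁻ (outside ∷ S) F x∈⋃ with ∈⋃⟨⟩⁻ S (F ∘ suc) x∈⋃
  ... | j , j∈S , x∈Fj = suc j , there j∈S , x∈Fj

  ∣⋃⟨⟩∣≤∑⟨⟩∣∣ : (S : Subset k) (F : Fin k → Subset n) → ∣ ⋃⟨ S ⟩ F ∣ ≤ ∑⟨ S ⟩ (∣_∣ ∘ F)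
  ∣⋃⟨⟩∣≤∑⟨⟩∣∣ {n = n} []    F = ℕ.≤-reflexive (∣⊥∣≡0 n)
  ∣⋃⟨⟩∣≤∑⟨⟩∣∣ (inside  ∷ S) F =
    ≤-trans (∣p∪q∣≤∣p∣+∣q∣ (F zero) _) (+-monoʳ-≤ ∣ F zero ∣ (∣⋃⟨⟩∣≤∑⟨⟩∣∣ S (F ∘ suc)))
  ∣⋃⟨⟩∣≤∑⟨⟩∣∣ (outside ∷ S) F = ∣⋃⟨⟩∣≤∑⟨⟩∣∣ S (F ∘ suc)

  ∣⋃⟨⟩∣≡∑⟨⟩∣∣ : (S : Subset k) (F : Fin k → Subset n) → PairwiseDisjoint F →
                ∣ ⋃⟨ S ⟩ F ∣ ≡ ∑⟨ S ⟩ (∣_∣ ∘ F)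
  ∣⋃⟨⟩∣≡∑⟨⟩∣∣ {n = n} []    F disjoint = ∣⊥∣≡0 n
  ∣⋃⟨⟩∣≡∑⟨⟩∣∣ (inside  ∷ S) F disjoint =
    trans (Empty[p∩q]⇒∣p∪q∣≡∣p∣+∣q∣ (F zero) (⋃⟨ S ⟩ (F ∘ suc)) F0∩⋃-empty)
          (cong (∣ F zero ∣ +_) (∣⋃⟨⟩∣≡∑⟨⟩∣∣ S (F ∘ suc) (PairwiseDisjoint-∘suc F disjoint)))
    where
    F0∩⋃-empty : Empty (F zero ∩ ⋃⟨ S ⟩ (F ∘ suc))
    F0∩⋃-empty (x , x∈∩) with x∈p∩q⁻ (F zero) _ x∈∩
    ... | x∈F0 , x∈⋃ with ∈⋃⟨⟩⁻ S (F ∘ suc) x∈⋃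
    ...   | j , _ , x∈Fj = disjoint zero (suc j) (λ ()) (x , x∈p∩q⁺ (x∈F0 , x∈Fj))
  ∣⋃⟨⟩∣≡∑⟨⟩∣∣ (outside ∷ S) F disjoint = ∣⋃⟨⟩∣≡∑⟨⟩∣∣ S (F ∘ suc) (PairwiseDisjoint-∘suc F disjoint)

  disjoint∧meets⇒∣S∣≤∣B∣ : (S : Subset k) (F : Fin k → Subset n) (B : Subset n) → PairwiseDisjoint F →
                          (∀ {j} → j ∈ S → Nonempty (F j ∩ B)) → ∣ S ∣ ≤ ∣ B ∣
  disjoint∧meets⇒∣S∣≤∣B∣ S F B disjoint meets = begin
    ∣ S ∣                  ≡⟨ ℕ.*-identityʳ ∣ S ∣ ⟨
    ∣ S ∣ * 1              ≡⟨ ∑⟨⟩-const S 1 ⟨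
    ∑⟨ S ⟩ (λ _ → 1)       ≤⟨ ∑⟨⟩-mono-≤ S (nonempty⇒1≤∣∣ ∘ meets) ⟩
    ∑⟨ S ⟩ (∣_∣ ∘ F∩B)     ≡⟨ ∣⋃⟨⟩∣≡∑⟨⟩∣∣ S F∩B F∩B-disjoint ⟨
    ∣ ⋃⟨ S ⟩ F∩B ∣         ≤⟨ p⊆q⇒∣p∣≤∣q∣ ⋃F∩B⊆B ⟩
    ∣ B ∣                  ∎
    where
    open ℕ.≤-Reasoning
    F∩B : Fin _ → Subset _
    F∩B j = F j ∩ B
    nonempty⇒1≤∣∣ : ∀ {p : Subset n} → Nonempty p → 1 ≤ ∣ p ∣
    nonempty⇒1≤∣∣ (x , x∈p) = ≤-trans (s≤s z≤n) (x∈p⇒∣p-x∣<∣p∣ x∈p)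
    F∩B-disjoint : PairwiseDisjoint F∩B
    F∩B-disjoint i j i≢j (x , x∈) = disjoint i j i≢j (x , x∈p∩q⁺ (p∩q⊆p _ _ x∈Fi∩B , p∩q⊆p _ _ x∈Fj∩B))
      where
      x∈Fi∩B = p∩q⊆p _ _ x∈
      x∈Fj∩B = p∩q⊆q _ _ x∈
    ⋃F∩B⊆B : ⋃⟨ S ⟩ F∩B ⊆ B
    ⋃F∩B⊆B x∈⋃ with ∈⋃⟨⟩⁻ S F∩B x∈⋃
    ... | _ , _ , x∈Fj∩B = p∩q⊆q _ _ x∈Fj∩B

module RationalArithmetic where

  open import Defs using (ℕ→ℚ; lead)
  open import Data.Nat as ℕ using (ℕ; suc; NonZero; _∸_)
  import Data.Nat.Properties as ℕ
  import Data.Nat.Coprimality as Coprimality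
  open import Data.Integer as ℤ using (+_)
  import Data.Integer.Properties as ℤ
  open import Data.Rational as ℚ
    using (ℚ; mkℚ; _/_; _+_; _*_; _-_; -_; _≤_; 0ℚ; 1ℚ; Positive; NonNegative; toℚᵘ)
  open import Data.Rational.Properties
  import Data.Rational.Unnormalised as ℚᵘ
  import Data.Rational.Unnormalised.Properties as ℚᵘ
  open import Data.Rational.Solver using (module +-*-Solver)
  open import Data.Fin using (Fin)
  open import Data.Fin.Subset using (Subset; inside; outside; _∈_; ∣_∣)
  open import Data.Vec using ([]; _∷_; here; there)
  open import Function using (_∘_)
  open import Relation.Binary.PropositionalEquality
  open SubsetCounting using (∑⟨_⟩)

  -- ℕ→ℚ n normalises through gcd n 1, which is stuck for a variable n.
  ℕ→ℚ≡mkℚ : ∀ n → ℕ→ℚ n ≡ mkℚ (+ n) 0 (Coprimality.sym (Coprimality.1-coprimeTo n))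
  ℕ→ℚ≡mkℚ n = ↥p/↧p≡p (mkℚ (+ n) 0 _)

  ℕ→ℚ-homo-+ : ∀ a b → ℕ→ℚ (a ℕ.+ b) ≡ ℕ→ℚ a + ℕ→ℚ b
  ℕ→ℚ-homo-+ a b rewrite ℕ→ℚ≡mkℚ a | ℕ→ℚ≡mkℚ b =
    /-cong (trans (ℤ.pos-+ a b) (sym (cong₂ ℤ._+_ (ℤ.*-identityʳ (+ a)) (ℤ.*-identityʳ (+ b))))) refl

  ℕ→ℚ-homo-* : ∀ a b → ℕ→ℚ (a ℕ.* b) ≡ ℕ→ℚ a * ℕ→ℚ b
  ℕ→ℚ-homo-* a b rewrite ℕ→ℚ≡mkℚ a | ℕ→ℚ≡mkℚ b = /-cong (ℤ.pos-* a b) refl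

  ℕ→ℚ-mono-≤ : ∀ {a b} → a ℕ.≤ b → ℕ→ℚ a ≤ ℕ→ℚ b
  ℕ→ℚ-mono-≤ {a} {b} a≤b rewrite ℕ→ℚ≡mkℚ a | ℕ→ℚ≡mkℚ b =
    ℚ.*≤* (subst₂ ℤ._≤_ (sym (ℤ.*-identityʳ (+ a))) (sym (ℤ.*-identityʳ (+ b))) (ℤ.+≤+ a≤b))

  ℕ→ℚ-nonNeg : ∀ n → NonNegative (ℕ→ℚ n)
  ℕ→ℚ-nonNeg n = normalize-nonNeg n 1

  ℕ→ℚ-pos : ∀ n .{{_ : NonZero n}} → Positive (ℕ→ℚ n)
  ℕ→ℚ-pos n = normalize-pos n 1

  ℕ→ℚ-*-/ : ∀ k d .{{_ : NonZero d}} → ℕ→ℚ d * (+ k / d) ≡ ℕ→ℚ k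
  ℕ→ℚ-*-/ k d@(suc d-1) = toℚᵘ-injective (begin
    toℚᵘ (ℕ→ℚ d * (+ k / d))                 ≈⟨ toℚᵘ-homo-* (ℕ→ℚ d) (+ k / d) ⟩
    toℚᵘ (ℕ→ℚ d) ℚᵘ.* toℚᵘ (+ k / d)         ≈⟨ ℚᵘ.*-cong (toℚᵘ-fromℚᵘ (ℚᵘ.mkℚᵘ (+ d) 0))
                                                           (toℚᵘ-fromℚᵘ (ℚᵘ.mkℚᵘ (+ k) d-1)) ⟩
    ℚᵘ.mkℚᵘ (+ d) 0 ℚᵘ.* ℚᵘ.mkℚᵘ (+ k) d-1   ≈⟨ ℚᵘ.*≡* d·k≡k·d ⟩
    ℚᵘ.mkℚᵘ (+ k) 0                          ≈⟨ toℚᵘ-fromℚᵘ (ℚᵘ.mkℚᵘ (+ k) 0) ⟨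
    toℚᵘ (ℕ→ℚ k)                             ∎)
    where
    open ℚᵘ.≃-Reasoning
    d·k≡k·d : (+ d ℤ.* + k) ℤ.* + 1 ≡ + k ℤ.* + suc (d-1 ℕ.+ 0)
    d·k≡k·d = trans (ℤ.*-identityʳ (+ d ℤ.* + k))
                (trans (ℤ.*-comm (+ d) (+ k)) (cong (λ e → + k ℤ.* + suc e) (sym (ℕ.+-identityʳ d-1))))

  ℓ²·lead+1≡ℓ² : ∀ ℓ .{{_ : NonZero ℓ}} → ℕ→ℚ ℓ * ℕ→ℚ ℓ * lead ℓ + 1ℚ ≡ ℕ→ℚ ℓ * ℕ→ℚ ℓ
  ℓ²·lead+1≡ℓ² ℓ = begin
    ℕ→ℚ ℓ * ℕ→ℚ ℓ * lead ℓ + 1ℚ   ≡⟨ cong (λ x → x * lead ℓ + 1ℚ) (ℕ→ℚ-homo-* ℓ ℓ) ⟨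
    ℕ→ℚ ℓ² * lead ℓ + 1ℚ          ≡⟨ cong (_+ 1ℚ) (ℕ→ℚ-*-/ (ℓ² ∸ 1) ℓ²) ⟩
    ℕ→ℚ (ℓ² ∸ 1) + ℕ→ℚ 1          ≡⟨ ℕ→ℚ-homo-+ (ℓ² ∸ 1) 1 ⟨
    ℕ→ℚ (ℓ² ∸ 1 ℕ.+ 1)            ≡⟨ cong ℕ→ℚ (ℕ.m∸n+n≡m (ℕ.>-nonZero⁻¹ ℓ²)) ⟩
    ℕ→ℚ ℓ²                        ≡⟨ ℕ→ℚ-homo-* ℓ ℓ ⟩
    ℕ→ℚ ℓ * ℕ→ℚ ℓ                 ∎
    where
    open ≡-Reasoning
    ℓ² = ℓ ℕ.* ℓ
    instance _ = ℕ.m*n≢0 ℓ ℓ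

  ∑⟨⟩-lowerBound : ∀ {k} (S : Subset k) (f : Fin k → ℕ) (q : ℚ) → (∀ {x} → x ∈ S → q ≤ ℕ→ℚ (f x)) →
                   ℕ→ℚ ∣ S ∣ * q ≤ ℕ→ℚ (∑⟨ S ⟩ f)
  ∑⟨⟩-lowerBound []            f q q≤f = ≤-reflexive (*-zeroˡ q)
  ∑⟨⟩-lowerBound (inside  ∷ S) f q q≤f = begin
    ℕ→ℚ (1 ℕ.+ ∣ S ∣) * q
      ≡⟨ cong (_* q) (ℕ→ℚ-homo-+ 1 ∣ S ∣) ⟩
    (1ℚ + ℕ→ℚ ∣ S ∣) * q
      ≡⟨ *-distribʳ-+ q 1ℚ (ℕ→ℚ ∣ S ∣) ⟩
    1ℚ * q + ℕ→ℚ ∣ S ∣ * q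
      ≡⟨ cong (_+ ℕ→ℚ ∣ S ∣ * q) (*-identityˡ q) ⟩
    q + ℕ→ℚ ∣ S ∣ * q
      ≤⟨ +-mono-≤ (q≤f here) (∑⟨⟩-lowerBound S (f ∘ Fin.suc) q (q≤f ∘ there)) ⟩
    ℕ→ℚ (f Fin.zero) + ℕ→ℚ (∑⟨ S ⟩ (f ∘ Fin.suc))
      ≡⟨ ℕ→ℚ-homo-+ (f Fin.zero) (∑⟨ S ⟩ (f ∘ Fin.suc)) ⟨
    ℕ→ℚ (∑⟨ inside ∷ S ⟩ f) ∎
    where open ≤-Reasoning
  ∑⟨⟩-lowerBound (outside ∷ S) f q q≤f = ∑⟨⟩-lowerBound S (f ∘ Fin.suc) q (q≤f ∘ there)

  p-q≤p : ∀ p q .{{_ : NonNegative q}} → p - q ≤ p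
  p-q≤p p q = begin
    p - q    ≤⟨ +-monoʳ-≤ p (neg-antimono-≤ (nonNegative⁻¹ q)) ⟩
    p - 0ℚ   ≡⟨ +-identityʳ p ⟩
    p        ∎
    where open ≤-Reasoning

  m·ℓ·α≤p : ∀ ℓ .{{_ : NonZero ℓ}} m p D (α : ℚ) →
            m ℕ.+ ℓ ℕ.* D ℕ.≤ ℓ ℕ.* p ℕ.+ ℓ ℕ.* ℓ ℕ.* m →
            ℕ→ℚ ℓ * (ℕ→ℚ m * (lead ℓ + α)) ≤ ℕ→ℚ D →
            ℕ→ℚ m * ℕ→ℚ ℓ * α ≤ ℕ→ℚ p
  m·ℓ·α≤p ℓ m p D α counted degrees = *-cancelˡ-≤-pos L {{ℕ→ℚ-pos ℓ}} (begin
    L * (M * L * α)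
      ≡⟨ rearrange L M (lead ℓ) α ⟩
    M + L * (L * (M * (lead ℓ + α))) - (L * L * lead ℓ + 1ℚ) * M
      ≡⟨ cong (λ x → M + L * (L * (M * (lead ℓ + α))) - x * M) (ℓ²·lead+1≡ℓ² ℓ) ⟩
    M + L * (L * (M * (lead ℓ + α))) - L * L * M
      ≤⟨ +-monoˡ-≤ (- (L * L * M)) (+-monoʳ-≤ M (*-monoˡ-≤-nonNeg L {{ℕ→ℚ-nonNeg ℓ}} degrees)) ⟩
    M + L * ℕ→ℚ D - L * L * M
      ≤⟨ +-monoˡ-≤ (- (L * L * M)) counted′ ⟩
    L * P + L * L * M - L * L * M
      ≡⟨ cancel L P M ⟩
    L * P ∎)
    where
    open ≤-Reasoning
    open +-*-Solver
    L = ℕ→ℚ ℓ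
    M = ℕ→ℚ m
    P = ℕ→ℚ p
    rearrange : ∀ L M ld α → L * (M * L * α) ≡ M + L * (L * (M * (ld + α))) - (L * L * ld + 1ℚ) * M
    rearrange = solve 4 (λ L M ld α →
      L :* (M :* L :* α) := M :+ L :* (L :* (M :* (ld :+ α))) :- (L :* L :* ld :+ con 1ℚ) :* M) refl
    cancel : ∀ L P M → L * P + L * L * M - L * L * M ≡ L * P
    cancel = solve 3 (λ L P M → L :* P :+ L :* L :* M :- L :* L :* M := L :* P) refl
    counted′ : M + L * ℕ→ℚ D ≤ L * P + L * L * M
    counted′ = subst₂ _≤_
      (trans (ℕ→ℚ-homo-+ m (ℓ ℕ.* D)) (cong (λ x → M + x) (ℕ→ℚ-homo-* ℓ D)))
      (trans (ℕ→ℚ-homo-+ (ℓ ℕ.* p) (ℓ ℕ.* ℓ ℕ.* m))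
             (cong₂ _+_ (ℕ→ℚ-homo-* ℓ p) (trans (ℕ→ℚ-homo-* (ℓ ℕ.* ℓ) m) (cong (_* M) (ℕ→ℚ-homo-* ℓ ℓ)))))
      (ℕ→ℚ-mono-≤ counted)

module CliquePartners where

  open import Defs hiding (sym)
  open import Data.Nat as ℕ using (ℕ; zero; suc; NonZero; _+_; _*_; _∸_; _/_; _%_; _≤_; _<_; z≤n)
  open import Data.Nat.Properties as ℕ
    using (≤-trans; +-monoˡ-≤; +-monoʳ-≤; *-monoˡ-≤; *-monoʳ-≤; +-monoˡ-<; +-suc; m≤n+m)
  open import Data.Nat.DivMod using (m≡m%n+[m/n]*n; m%n<n)
  open import Data.Nat.Tactic.RingSolver using (solve-∀)
  open import Data.Fin using (Fin; _≟_)
  open import Data.Fin.Subset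
  open import Data.Fin.Subset.Properties
  open import Data.Bool using (true; false)
  open import Data.Product using (_×_; _,_; proj₁; proj₂)
  open import Data.Sum using (inj₁; inj₂)
  open import Function using (_∘_)
  open import Relation.Nullary using (¬_; yes; no; ¬?; contradiction)
  open import Relation.Unary using (Decidable)
  open import Relation.Nullary.Decidable using (_×-dec_)
  open import Relation.Binary.PropositionalEquality
  open SubsetCounting

  private variable
    m : ℕ

  adj≡false⇒∈∁N : (G : Graph m) {u w : Fin m} → adj G u w ≡ false → w ∈ ∁ (N G u)
  adj≡false⇒∈∁N G u≁w = x∉p⇒x∈∁p (λ w∈N → contradiction (trans (sym (∈tabulate⁻ w∈N)) u≁w) λ ())

  ∣∁N─S∣+1+deg≤m : (G : Graph m) {u : Fin m} (S : Subset m) → u ∈ S → ∣ ∁ (N G u) ─ S ∣ + (1 + deg G u) ≤ m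
  ∣∁N─S∣+1+deg≤m {m} G {u} S u∈S = begin
    ∣ ∁ (N G u) ─ S ∣ + (1 + deg G u)  ≡⟨ +-suc ∣ ∁ (N G u) ─ S ∣ (deg G u) ⟩
    suc ∣ ∁ (N G u) ─ S ∣ + deg G u    ≤⟨ +-monoˡ-≤ (deg G u) (p∩q≢∅⇒∣p─q∣<∣p∣ (∁ (N G u)) S (u , u∈∁N∩S)) ⟩
    ∣ ∁ (N G u) ∣ + deg G u            ≡⟨ cong (_+ deg G u) (∣∁p∣≡n∸∣p∣ (N G u)) ⟩
    m ∸ deg G u + deg G u              ≡⟨ ℕ.m∸n+n≡m (∣p∣≤n (N G u)) ⟩
    m                                  ∎
    where
    open ℕ.≤-Reasoning
    u∈∁N∩S = x∈p∩q⁺ (adj≡false⇒∈∁N G (irrefl G u) , u∈S)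

  m<[1+m/n]*n : ∀ m n .{{_ : NonZero n}} → m < suc (m / n) * n
  m<[1+m/n]*n m n = begin-strict
    m                  ≡⟨ m≡m%n+[m/n]*n m n ⟩
    m % n + m / n * n  <⟨ +-monoˡ-< (m / n * n) (m%n<n m n) ⟩
    n + m / n * n      ∎
    where open ℕ.≤-Reasoning

  m+m≤m*m+1 : ∀ m → m + m ≤ m * m + 1
  m+m≤m*m+1 zero    = z≤n
  m+m≤m*m+1 (suc k) = ≤-trans (m≤n+m (suc k + suc k) (k * k)) (ℕ.≤-reflexive (square k))
    where
    square : ∀ k → k * k + ((1 + k) + (1 + k)) ≡ (1 + k) * (1 + k) + 1
    square = solve-∀

  m+ℓD≤ℓp+ℓ²m : ∀ {ℓ n m p b β D} → n ≤ p + (1 + b) → b ≤ β → β + (ℓ + D) ≤ ℓ * m → m < suc n * ℓ →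
                  m + ℓ * D ≤ ℓ * p + ℓ * ℓ * m
  m+ℓD≤ℓp+ℓ²m {ℓ} {n} {m} {p} {b} {β} {D} n≤ b≤β β+ℓ+D≤ℓm m< = ℕ.+-cancelʳ-≤ (ℓ * ℓ + 1) _ _ (begin
    m + ℓ * D + (ℓ * ℓ + 1)                 ≡⟨ regroup₁ m ℓ D ⟩
    suc m + ℓ * (ℓ + D)                     ≤⟨ +-monoˡ-≤ (ℓ * (ℓ + D)) m< ⟩
    suc n * ℓ + ℓ * (ℓ + D)                 ≤⟨ +-monoˡ-≤ (ℓ * (ℓ + D)) (*-monoˡ-≤ ℓ (ℕ.s≤s n≤p+1+β)) ⟩
    suc (p + (1 + β)) * ℓ + ℓ * (ℓ + D)     ≡⟨ regroup₂ p β ℓ D ⟩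
    ℓ * p + (ℓ + ℓ) + ℓ * (β + (ℓ + D))     ≤⟨ +-monoʳ-≤ (ℓ * p + (ℓ + ℓ)) (*-monoʳ-≤ ℓ β+ℓ+D≤ℓm) ⟩
    ℓ * p + (ℓ + ℓ) + ℓ * (ℓ * m)           ≤⟨ +-monoˡ-≤ (ℓ * (ℓ * m)) (+-monoʳ-≤ (ℓ * p) (m+m≤m*m+1 ℓ)) ⟩
    ℓ * p + (ℓ * ℓ + 1) + ℓ * (ℓ * m)       ≡⟨ regroup₃ p ℓ m ⟩
    ℓ * p + ℓ * ℓ * m + (ℓ * ℓ + 1)         ∎)
    where
    open ℕ.≤-Reasoning
    n≤p+1+β : n ≤ p + (1 + β)
    n≤p+1+β = ≤-trans n≤ (+-monoʳ-≤ p (+-monoʳ-≤ 1 b≤β))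
    regroup₁ : ∀ m ℓ D → m + ℓ * D + (ℓ * ℓ + 1) ≡ (1 + m) + ℓ * (ℓ + D)
    regroup₁ = solve-∀
    regroup₂ : ∀ p β ℓ D → (1 + (p + (1 + β))) * ℓ + ℓ * (ℓ + D) ≡ ℓ * p + (ℓ + ℓ) + ℓ * (β + (ℓ + D))
    regroup₂ = solve-∀
    regroup₃ : ∀ p ℓ m → ℓ * p + (ℓ * ℓ + 1) + ℓ * (ℓ * m) ≡ ℓ * p + ℓ * ℓ * m + (ℓ * ℓ + 1)
    regroup₃ = solve-∀

  module Partners {m n ℓ : ℕ} (G : Graph m) (C : Fin n → Subset m)
                  (copies : ∀ j → IsCopyOfK G ℓ (C j)) (disjoint : PairwiseDisjoint C) (i : Fin n) where

    unjoined : Subset m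
    unjoined = ⋃⟨ C i ⟩ (λ u → ∁ (N G u) ─ C i)

    Blocked : Fin n → Set
    Blocked j = Nonempty (C j ∩ unjoined)

    IsPartner : Fin n → Set
    IsPartner j = j ≢ i × ¬ Blocked j

    blocked? : Decidable Blocked
    blocked? j = nonempty? (C j ∩ unjoined)

    isPartner? : Decidable IsPartner
    isPartner? j = ¬? (j ≟ i) ×-dec ¬? (blocked? j)

    blocked : Subset n
    blocked = satisfying blocked?

    partners : Subset n
    partners = satisfying isPartner?

    i∉partners : i ∉ partners
    i∉partners i∈partners = proj₁ (∈satisfying⁻ isPartner? i∈partners) refl

    partner-joined : ∀ {j u w} → j ∈ partners → u ∈ C i → w ∈ C j → adj G u w ≡ true
    partner-joined {j} {u} {w} j∈partners u∈Ci w∈Cj with adj G u w in u≁w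
    ... | true  = refl
    ... | false = contradiction (w , x∈p∩q⁺ (w∈Cj , w∈unjoined)) ¬blocked
      where
      j≢i : j ≢ i
      j≢i = proj₁ (∈satisfying⁻ isPartner? j∈partners)
      ¬blocked : ¬ Blocked j
      ¬blocked = proj₂ (∈satisfying⁻ isPartner? j∈partners)
      w∉Ci : w ∉ C i
      w∉Ci w∈Ci = disjoint i j (j≢i ∘ sym) (w , x∈p∩q⁺ (w∈Ci , w∈Cj))
      w∈unjoined : w ∈ unjoined
      w∈unjoined = ∈⋃⟨⟩⁺ (C i) _ u∈Ci (x∈p∧x∉q⇒x∈p─q (adj≡false⇒∈∁N G u≁w) w∉Ci)

    partners-clique : ∀ j → j ∈ partners → IsClique G (C i ∪ C j)
    partners-clique j j∈partners u v u∈ v∈ u≢v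
      with x∈p∪q⁻ (C i) (C j) u∈ | x∈p∪q⁻ (C i) (C j) v∈
    ... | inj₁ u∈Ci | inj₁ v∈Ci = proj₂ (copies i) u v u∈Ci v∈Ci u≢v
    ... | inj₂ u∈Cj | inj₂ v∈Cj = proj₂ (copies j) u v u∈Cj v∈Cj u≢v
    ... | inj₁ u∈Ci | inj₂ v∈Cj = partner-joined j∈partners u∈Ci v∈Cj
    ... | inj₂ u∈Cj | inj₁ v∈Ci = trans (Graph.sym G u v) (partner-joined j∈partners v∈Ci u∈Cj)

    every-index-covered : ∀ j → j ∈ partners ∪ (⁅ i ⁆ ∪ blocked)
    every-index-covered j with j ≟ i | blocked? j
    ... | yes refl | _            = x∈p∪q⁺ (inj₂ (x∈p∪q⁺ (inj₁ (x∈⁅x⁆ i))))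
    ... | no j≢i   | yes isBlocked = x∈p∪q⁺ (inj₂ (x∈p∪q⁺ (inj₂ (∈satisfying⁺ blocked? isBlocked))))
    ... | no j≢i   | no ¬blocked  = x∈p∪q⁺ (inj₁ (∈satisfying⁺ isPartner? (j≢i , ¬blocked)))

    n≤∣partners∣+1+∣blocked∣ : n ≤ ∣ partners ∣ + (1 + ∣ blocked ∣)
    n≤∣partners∣+1+∣blocked∣ = begin
      n                                     ≡⟨ ∣⊤∣≡n n ⟨
      ∣ ⊤ {n = n} ∣                         ≤⟨ p⊆q⇒∣p∣≤∣q∣ {p = ⊤} (λ {j} _ → every-index-covered j) ⟩
      ∣ partners ∪ (⁅ i ⁆ ∪ blocked) ∣      ≤⟨ ∣p∪q∣≤∣p∣+∣q∣ partners (⁅ i ⁆ ∪ blocked) ⟩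
      ∣ partners ∣ + ∣ ⁅ i ⁆ ∪ blocked ∣    ≤⟨ +-monoʳ-≤ ∣ partners ∣ (∣p∪q∣≤∣p∣+∣q∣ ⁅ i ⁆ blocked) ⟩
      ∣ partners ∣ + (∣ ⁅ i ⁆ ∣ + ∣ blocked ∣) ≡⟨ cong (λ s → ∣ partners ∣ + (s + ∣ blocked ∣)) (∣⁅x⁆∣≡1 i) ⟩
      ∣ partners ∣ + (1 + ∣ blocked ∣)      ∎
      where open ℕ.≤-Reasoning

    ∣blocked∣≤∣unjoined∣ : ∣ blocked ∣ ≤ ∣ unjoined ∣
    ∣blocked∣≤∣unjoined∣ = disjoint∧meets⇒∣S∣≤∣B∣ blocked C unjoined disjoint (∈satisfying⁻ blocked?)

    ∣unjoined∣+ℓ+∑deg≤ℓm : ∣ unjoined ∣ + (ℓ + ∑⟨ C i ⟩ (deg G)) ≤ ℓ * m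
    ∣unjoined∣+ℓ+∑deg≤ℓm = begin
      ∣ unjoined ∣ + (ℓ + ∑⟨ C i ⟩ (deg G))
        ≤⟨ +-monoˡ-≤ _ (∣⋃⟨⟩∣≤∑⟨⟩∣∣ (C i) away) ⟩
      ∑⟨ C i ⟩ (∣_∣ ∘ away) + (ℓ + ∑⟨ C i ⟩ (deg G))
        ≡⟨ cong (λ s → ∑⟨ C i ⟩ (∣_∣ ∘ away) + (s + ∑⟨ C i ⟩ (deg G))) ∑⟨Ci⟩1≡ℓ ⟨
      ∑⟨ C i ⟩ (∣_∣ ∘ away) + (∑⟨ C i ⟩ (λ _ → 1) + ∑⟨ C i ⟩ (deg G))
        ≡⟨ cong (∑⟨ C i ⟩ (∣_∣ ∘ away) +_) (∑⟨⟩-distrib-+ (C i) (λ _ → 1) (deg G)) ⟨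
      ∑⟨ C i ⟩ (∣_∣ ∘ away) + ∑⟨ C i ⟩ (λ u → 1 + deg G u)
        ≡⟨ ∑⟨⟩-distrib-+ (C i) (∣_∣ ∘ away) (λ u → 1 + deg G u) ⟨
      ∑⟨ C i ⟩ (λ u → ∣ away u ∣ + (1 + deg G u))
        ≤⟨ ∑⟨⟩-mono-≤ (C i) (∣∁N─S∣+1+deg≤m G (C i)) ⟩
      ∑⟨ C i ⟩ (λ _ → m)
        ≡⟨ ∑⟨⟩-const (C i) m ⟩
      ∣ C i ∣ * m
        ≡⟨ cong (_* m) (proj₁ (copies i)) ⟩
      ℓ * m ∎
      where
      open ℕ.≤-Reasoning
      away : Fin m → Subset m
      away u = ∁ (N G u) ─ C i
      ∑⟨Ci⟩1≡ℓ : ∑⟨ C i ⟩ (λ _ → 1) ≡ ℓ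
      ∑⟨Ci⟩1≡ℓ = trans (∑⟨⟩-const (C i) 1) (trans (ℕ.*-identityʳ ∣ C i ∣) (proj₁ (copies i)))

open import Defs
open import Data.Nat using (ℕ; NonZero; _≥_; _*_; _∸_; _/_)
open import Data.Rational using (ℚ; _<_; _≤_; _+_; _-_; 0ℚ)
open import Data.Fin using (Fin)
open import Data.Fin.Subset using (Subset; _∈_; _∉_; _∪_; _∩_; Empty; ∣_∣)
open import Data.Product using (_×_; _,_; proj₁; ∃-syntax)
open import Data.Rational.Properties using (≤-trans)
open import Relation.Binary.PropositionalEquality using (_≢_; subst)
open SubsetCounting using (PairwiseDisjoint; ∑⟨_⟩)
open RationalArithmetic using (ℕ→ℚ-nonNeg; ∑⟨⟩-lowerBound; p-q≤p; m·ℓ·α≤p)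
open CliquePartners using (m<[1+m/n]*n; m+ℓD≤ℓp+ℓ²m; module Partners)

clique-partners : (ℓ : ℕ) .{{_ : NonZero ℓ}} (α : ℚ) (m : ℕ) (G : Graph m) →
  (∀ v → ℕ→ℚ m Data.Rational.* (lead ℓ + α) ≤ ℕ→ℚ (deg G v)) →
  (C : Fin (m / ℓ) → Subset m) → (∀ i → IsCopyOfK G ℓ (C i)) → PairwiseDisjoint C →
  ∀ i → ∃[ J ] (i ∉ J × (∀ j → j ∈ J → IsClique G (C i ∪ C j)) ×
                (ℕ→ℚ m Data.Rational.* ℕ→ℚ ℓ Data.Rational.* α ≤ ℕ→ℚ ∣ J ∣))
clique-partners ℓ α m G minDegree C copies disjoint i =
  partners , i∉partners , partners-clique ,
  m·ℓ·α≤p ℓ m ∣ partners ∣ degreeSum α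
    (m+ℓD≤ℓp+ℓ²m n≤∣partners∣+1+∣blocked∣ ∣blocked∣≤∣unjoined∣ ∣unjoined∣+ℓ+∑deg≤ℓm (m<[1+m/n]*n m ℓ))
    ℓm[lead+α]≤degreeSum
  where
  open Partners G C copies disjoint i
  degreeSum : ℕ
  degreeSum = ∑⟨ C i ⟩ (deg G)
  ℓm[lead+α]≤degreeSum : ℕ→ℚ ℓ Data.Rational.* (ℕ→ℚ m Data.Rational.* (lead ℓ + α)) ≤ ℕ→ℚ degreeSum
  ℓm[lead+α]≤degreeSum = subst (λ s → ℕ→ℚ s Data.Rational.* _ ≤ ℕ→ℚ degreeSum) (proj₁ (copies i))
    (∑⟨⟩-lowerBound (C i) (deg G) _ (λ {u} _ → minDegree u))

lemma2 : (ℓ : ℕ) → .{{_ : NonZero ℓ}} → (α : ℚ) → 0ℚ < α → α < inv-sq ℓ →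
    ∃[ M ] (∀ (m : ℕ) → m ≥ M → (G : Graph m) →
      (∀ v → ℕ→ℚ m Data.Rational.* (lead ℓ + α) ≤ ℕ→ℚ (deg G v)) →
      (C : Fin (m / ℓ) → Subset m) →
      (∀ i → IsCopyOfK G ℓ (C i)) →
      (∀ i j → i ≢ j → Empty (C i ∩ C j)) →
      ∀ i → ∃[ J ] (i ∉ J × (∀ j → j ∈ J → IsClique G (C i ∪ C j)) ×
        (ℕ→ℚ m Data.Rational.* ℕ→ℚ ℓ Data.Rational.* α - ℕ→ℚ (ℓ * (ℓ ∸ 1)) ≤ ℕ→ℚ ∣ J ∣)))
lemma2 ℓ α _ _ = 0 , λ m _ G minDegree C copies disjoint i →
  let J , i∉J , cliques , mℓα≤∣J∣ = clique-partners ℓ α m G minDegree C copies disjoint i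
  in  J , i∉J , cliques , ≤-trans (p-q≤p _ _ {{ℕ→ℚ-nonNeg (ℓ * (ℓ ∸ 1))}}) mℓα≤∣J∣
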